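{- Let $k\ge2$ and let $G$ be a strong $k$-chromatic-choosable graph with $n$ vertices and $e$ edges, where $e\le n(k-2)$. If $L$ is a list assignment for $G$ with $|L(v)|\ge k-1$ for every $v\in V(G)$ and $L$ is not a constant $(k-1)$-assignment, then $G$ has at least two proper $L$-colorings.
   Context: A list assignment gives each vertex a color set $L(v)$; a $k$-assignment has all lists of size $k$; a proper $L$-coloring is a proper coloring $f$ with $f(v)\in L(v)$ for all $v$. A list assignment is constant if all lists are equal. $G$ is strong $k$-chromatic-choosable if $\chi(G)=k$ and every $(k-1)$-assignment $L$ for which $G$ has no proper $L$-coloring is constant. -}

module Defs where

open import Data.Nat using (ℕ; _+_; _*_; _∸_; _≤_; _<ᵇ_)
open import Data.Bool using (Bool; true; false; if_then_else_; _∧_)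
open import Data.Fin using (Fin; toℕ)
open import Data.List using (List; length; map; allFin)
open import Data.Nat.ListAction using (sum)
open import Data.List.Membership.Propositional using (_∈_)
open import Data.List.Relation.Unary.Unique.Propositional using (Unique)
open import Data.Product using (Σ; _×_; ∃-syntax)
open import Relation.Binary.PropositionalEquality using (_≡_; _≢_)
open import Relation.Nullary using (¬_)
open import Function.Bundles using (_⇔_)

record Graph (n : ℕ) : Set where
  field
    adj   : Fin n → Fin n → Bool
    sym   : ∀ u v → adj u v ≡ adj v u
    irrefl : ∀ v → adj v v ≡ false
open Graph public

Adj : ∀ {n} → Graph n → Fin n → Fin n → Set
Adj G u v = adj G u v ≡ true

edgeCount : ∀ {n} → Graph n → ℕ
edgeCount {n} G =
  sum (map (λ u → sum (map (λ v → if (toℕ u <ᵇ toℕ v) ∧ adj G u v then 1 else 0)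
                           (allFin n)))
           (allFin n))

ProperColoring : ∀ {n} → Graph n → (k : ℕ) → (Fin n → Fin k) → Set
ProperColoring G k f = ∀ u v → Adj G u v → f u ≢ f v

-- chromatic number equals k (k ≥ 1 implicit by usage): k-colorable, not (k-1)-colorable
ChromaticNumber : ∀ {n} → Graph n → ℕ → Set
ChromaticNumber G k =
  (Σ (_ → Fin k) (ProperColoring G k)) × ¬ (Σ (_ → Fin (k ∸ 1)) (ProperColoring G (k ∸ 1)))

-- A list assignment: each vertex gets a finite set of colors (a duplicate-free list of ℕ).
ListAssignment : ℕ → Set
ListAssignment n = Fin n → List ℕ

WellFormed : ∀ {n} → ListAssignment n → Set
WellFormed L = ∀ v → Unique (L v)

IsAssignment : ∀ {n} → ℕ → ListAssignment n → Set
IsAssignment k L = WellFormed L × (∀ v → length (L v) ≡ k)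

Constant : ∀ {n} → ListAssignment n → Set
Constant L = ∀ u v c → (c ∈ L u) ⇔ (c ∈ L v)

ProperLColoring : ∀ {n} → Graph n → ListAssignment n → (Fin n → ℕ) → Set
ProperLColoring G L f = (∀ v → f v ∈ L v) × (∀ u v → Adj G u v → f u ≢ f v)

LColorable : ∀ {n} → Graph n → ListAssignment n → Set
LColorable G L = Σ (_ → ℕ) (ProperLColoring G L)

StrongChromaticChoosable : ∀ {n} → Graph n → ℕ → Set
StrongChromaticChoosable {n} G k =
  ChromaticNumber G k ×
  (∀ (L : ListAssignment n) → IsAssignment (k ∸ 1) L → ¬ LColorable G L → Constant L)

module Submission where

-- Shrinking L to a non-constant (k − 1)-assignment and applying strong chromatic-choosability gives a
-- proper L-colouring f. Suppose f were the only one, and let P = ∏_{uv ∈ E} (x_u − x_v), of degree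
-- e ≤ n (k − 2) ≤ ∑ᵥ (|L(v)| − 1). By the coefficient formula of the Combinatorial Nullstellensatz the
-- coefficient of ∏ᵥ x_v^(|L(v)| − 1) in P is ∑_{x ∈ ∏ᵥ L(v)} P(x) / ∏ᵥ ∏_{s ∈ L(v), s ≠ x_v} (x_v − s),
-- whose only nonzero term is the one at x = f. Yet this coefficient vanishes: for degree reasons if
-- e < ∑ᵥ (|L(v)| − 1), and otherwise all lists have size k − 1, so the same formula over the constant
-- lists {0, …, k − 2} expresses it as a sum of zeros, G not being (k − 1)-colourable.

module Rational where

  open import Data.Nat.Base using (ℕ)
  import Data.Nat.Coprimality as Coprime
  open import Function.Base using (_∘_)
  open import Data.Integer.Base using (+_)
  import Data.Integer.Properties as ℤ
  open import Data.Rational.Base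
  open import Data.Rational.Properties
  open import Data.Rational.Solver using (module +-*-Solver)
  open import Relation.Binary.PropositionalEquality
  open import Relation.Nullary using (yes; no)
  open import Data.Empty using (⊥-elim)
  open +-*-Solver

  -- Total inverse; the junk value 0 ⁻¹ = 0 is never used.
  _⁻¹ : ℚ → ℚ
  p ⁻¹ with p ≟ 0ℚ
  ... | yes _  = 0ℚ
  ... | no p≢0 = (1/ p) {{≢-nonZero p≢0}}

  ⁻¹-inverseˡ : ∀ p → p ≢ 0ℚ → p ⁻¹ * p ≡ 1ℚ
  ⁻¹-inverseˡ p p≢0 with p ≟ 0ℚ
  ... | yes p≡0 = ⊥-elim (p≢0 p≡0)
  ... | no p≢0′ = *-inverseˡ p {{≢-nonZero p≢0′}}

  ⁻¹-inverseʳ : ∀ p → p ≢ 0ℚ → p * p ⁻¹ ≡ 1ℚ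
  ⁻¹-inverseʳ p p≢0 = trans (*-comm p (p ⁻¹)) (⁻¹-inverseˡ p p≢0)

  p≢0∧p*q≡0⇒q≡0 : ∀ p q → p ≢ 0ℚ → p * q ≡ 0ℚ → q ≡ 0ℚ
  p≢0∧p*q≡0⇒q≡0 p q p≢0 pq≡0 = begin
    q                ≡⟨ sym (*-identityˡ q) ⟩
    1ℚ * q           ≡⟨ cong (_* q) (sym (⁻¹-inverseˡ p p≢0)) ⟩
    p ⁻¹ * p * q     ≡⟨ *-assoc (p ⁻¹) p q ⟩
    p ⁻¹ * (p * q)   ≡⟨ cong (p ⁻¹ *_) pq≡0 ⟩
    p ⁻¹ * 0ℚ        ≡⟨ *-zeroʳ (p ⁻¹) ⟩
    0ℚ               ∎
    where open ≡-Reasoning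

  p≢0∧q≢0⇒p*q≢0 : ∀ {p q} → p ≢ 0ℚ → q ≢ 0ℚ → p * q ≢ 0ℚ
  p≢0∧q≢0⇒p*q≢0 {p} {q} p≢0 q≢0 pq≡0 = q≢0 (p≢0∧p*q≡0⇒q≡0 p q p≢0 pq≡0)

  ⁻¹-≢0 : ∀ p → p ≢ 0ℚ → p ⁻¹ ≢ 0ℚ
  ⁻¹-≢0 p p≢0 p⁻¹≡0 = 1≢0 (begin
    1ℚ          ≡⟨ sym (⁻¹-inverseˡ p p≢0) ⟩
    p ⁻¹ * p    ≡⟨ cong (_* p) p⁻¹≡0 ⟩
    0ℚ * p      ≡⟨ *-zeroˡ p ⟩
    0ℚ          ∎)
    where open ≡-Reasoning

  ⁻¹-distrib-* : ∀ p q → p ≢ 0ℚ → q ≢ 0ℚ → (p * q) ⁻¹ ≡ p ⁻¹ * q ⁻¹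
  ⁻¹-distrib-* p q p≢0 q≢0 = begin
    (p * q) ⁻¹                                 ≡⟨ sym (*-identityʳ _) ⟩
    (p * q) ⁻¹ * 1ℚ                            ≡⟨ cong ((p * q) ⁻¹ *_) (sym pq*p⁻¹q⁻¹≡1) ⟩
    (p * q) ⁻¹ * ((p * q) * (p ⁻¹ * q ⁻¹))     ≡⟨ sym (*-assoc ((p * q) ⁻¹) (p * q) _) ⟩
    (p * q) ⁻¹ * (p * q) * (p ⁻¹ * q ⁻¹)       ≡⟨ cong (_* (p ⁻¹ * q ⁻¹))
                                                     (⁻¹-inverseˡ (p * q) (p≢0∧q≢0⇒p*q≢0 p≢0 q≢0)) ⟩
    1ℚ * (p ⁻¹ * q ⁻¹)                         ≡⟨ *-identityˡ _ ⟩
    p ⁻¹ * q ⁻¹                                ∎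
    where
    open ≡-Reasoning
    pq*p⁻¹q⁻¹≡1 : (p * q) * (p ⁻¹ * q ⁻¹) ≡ 1ℚ
    pq*p⁻¹q⁻¹≡1 = begin
      (p * q) * (p ⁻¹ * q ⁻¹)      ≡⟨ solve 4 (λ p q p′ q′ → (p :* q) :* (p′ :* q′) := (p :* p′) :* (q :* q′))
                                         refl p q (p ⁻¹) (q ⁻¹) ⟩
      (p * p ⁻¹) * (q * q ⁻¹)      ≡⟨ cong₂ _*_ (⁻¹-inverseʳ p p≢0) (⁻¹-inverseʳ q q≢0) ⟩
      1ℚ * 1ℚ                      ≡⟨⟩
      1ℚ                           ∎

  p-q≡0⇒p≡q : ∀ p q → p - q ≡ 0ℚ → p ≡ q
  p-q≡0⇒p≡q p q p-q≡0 = begin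
    p               ≡⟨ solve 2 (λ p q → p := (p :- q) :+ q) refl p q ⟩
    (p - q) + q     ≡⟨ cong (_+ q) p-q≡0 ⟩
    0ℚ + q          ≡⟨ +-identityˡ q ⟩
    q               ∎
    where open ≡-Reasoning

  p≢q⇒p-q≢0 : ∀ {p q} → p ≢ q → p - q ≢ 0ℚ
  p≢q⇒p-q≢0 {p} {q} p≢q = p≢q ∘ p-q≡0⇒p≡q p q

  fromℕ : ℕ → ℚ
  fromℕ n = mkℚ (+ n) 0 (Coprime.sym (Coprime.1-coprimeTo n))

  fromℕ-injective : ∀ {m n} → fromℕ m ≡ fromℕ n → m ≡ n
  fromℕ-injective eq = ℤ.+-injective (cong ↥_ eq)

module DividedDifference where

  open import Data.Rational.Base
  open import Data.Rational.Properties
  open import Data.Rational.Solver using (module +-*-Solver)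
  open import Data.List.Base using (List; []; _∷_)
  open import Data.List.Membership.Propositional using (_∈_)
  open import Data.List.Relation.Unary.Any using (here; there)
  open import Data.List.Relation.Unary.All as All using (All; _∷_)
  open import Data.List.Relation.Unary.AllPairs using (_∷_)
  open import Data.List.Relation.Unary.Unique.Propositional using (Unique)
  open import Relation.Binary.PropositionalEquality
  open import Relation.Nullary using (yes; no)
  open import Data.Empty using (⊥-elim)
  open import Function.Base using (_∘_)
  open +-*-Solver
  open Rational

  sumOver : List ℚ → (ℚ → ℚ) → ℚ
  sumOver []      f = 0ℚ
  sumOver (t ∷ T) f = f t + sumOver T f

  sumOver-cong : ∀ T {f g} → (∀ {t} → t ∈ T → f t ≡ g t) → sumOver T f ≡ sumOver T g
  sumOver-cong []      f≡g = refl
  sumOver-cong (t ∷ T) f≡g = cong₂ _+_ (f≡g (here refl)) (sumOver-cong T (f≡g ∘ there))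

  sumOver-+ : ∀ T f g → sumOver T (λ t → f t + g t) ≡ sumOver T f + sumOver T g
  sumOver-+ []      f g = refl
  sumOver-+ (t ∷ T) f g = begin
    (f t + g t) + sumOver T (λ t → f t + g t)   ≡⟨ cong ((f t + g t) +_) (sumOver-+ T f g) ⟩
    (f t + g t) + (sumOver T f + sumOver T g)   ≡⟨ solve 4 (λ a b c d → (a :+ b) :+ (c :+ d) := (a :+ c) :+ (b :+ d))
                                                     refl (f t) (g t) (sumOver T f) (sumOver T g) ⟩
    (f t + sumOver T f) + (g t + sumOver T g)   ∎
    where open ≡-Reasoning

  sumOver-*ˡ : ∀ T c f → sumOver T (λ t → c * f t) ≡ c * sumOver T f
  sumOver-*ˡ []      c f = sym (*-zeroʳ c)
  sumOver-*ˡ (t ∷ T) c f =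
    trans (cong (c * f t +_) (sumOver-*ˡ T c f)) (sym (*-distribˡ-+ c (f t) (sumOver T f)))

  sumOver-≡0 : ∀ T f → (∀ {t} → t ∈ T → f t ≡ 0ℚ) → sumOver T f ≡ 0ℚ
  sumOver-≡0 T f f≡0 = trans (sumOver-cong T f≡0) (zeros T)
    where
    zeros : ∀ T → sumOver T (λ _ → 0ℚ) ≡ 0ℚ
    zeros []      = refl
    zeros (t ∷ T) = trans (+-identityˡ _) (zeros T)

  sumOver-single : ∀ T f {a} → Unique T → a ∈ T → (∀ {t} → t ∈ T → t ≢ a → f t ≡ 0ℚ) →
                   sumOver T f ≡ f a
  sumOver-single (t ∷ T) f (t∉T ∷ _) (here refl) f≡0 =
    trans (cong (f t +_) (sumOver-≡0 T f (λ t′∈T → f≡0 (there t′∈T) (All.lookup t∉T t′∈T ∘ sym))))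
          (+-identityʳ (f t))
  sumOver-single (t ∷ T) f {a} (t∉T ∷ T-unique) (there a∈T) f≡0 =
    trans (cong₂ _+_ (f≡0 (here refl) (All.lookup t∉T a∈T)) (sumOver-single T f T-unique a∈T (f≡0 ∘ there)))
          (+-identityˡ (f a))

  gap : ℚ → ℚ → ℚ
  gap s t with s ≟ t
  ... | yes _ = 1ℚ
  ... | no  _ = t - s

  gap-≢ : ∀ {s t} → s ≢ t → gap s t ≡ t - s
  gap-≢ {s} {t} s≢t with s ≟ t
  ... | yes s≡t = ⊥-elim (s≢t s≡t)
  ... | no  _   = refl

  gap-refl : ∀ t → gap t t ≡ 1ℚ
  gap-refl t with t ≟ t
  ... | yes _  = refl
  ... | no t≢t = ⊥-elim (t≢t refl)

  gap-≢0 : ∀ s t → gap s t ≢ 0ℚ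
  gap-≢0 s t with s ≟ t
  ... | yes _   = 1≢0
  ... | no  s≢t = p≢q⇒p-q≢0 (s≢t ∘ sym)

  nodeProduct : List ℚ → ℚ → ℚ
  nodeProduct []      t = 1ℚ
  nodeProduct (s ∷ T) t = gap s t * nodeProduct T t

  nodeProduct-≢0 : ∀ T t → nodeProduct T t ≢ 0ℚ
  nodeProduct-≢0 []      t = 1≢0
  nodeProduct-≢0 (s ∷ T) t = p≢0∧q≢0⇒p*q≢0 (gap-≢0 s t) (nodeProduct-≢0 T t)

  -- For distinct nodes T, the divided difference g[T] = ∑_{t ∈ T} g t / ∏_{s ∈ T, s ≠ t} (t - s).
  divDiff : List ℚ → (ℚ → ℚ) → ℚ
  divDiff T g = sumOver T (λ t → g t * nodeProduct T t ⁻¹)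

  divDiff-cong : ∀ T {f g} → f ≗ g → divDiff T f ≡ divDiff T g
  divDiff-cong T f≡g = sumOver-cong T (λ {t} _ → cong (_* nodeProduct T t ⁻¹) (f≡g t))

  divDiff-+ : ∀ T f g → divDiff T (λ t → f t + g t) ≡ divDiff T f + divDiff T g
  divDiff-+ T f g =
    trans (sumOver-cong T (λ {t} _ → *-distribʳ-+ (nodeProduct T t ⁻¹) (f t) (g t))) (sumOver-+ T _ _)

  divDiff-*ˡ : ∀ T c f → divDiff T (λ t → c * f t) ≡ c * divDiff T f
  divDiff-*ˡ T c f =
    trans (sumOver-cong T (λ {t} _ → *-assoc c (f t) (nodeProduct T t ⁻¹))) (sumOver-*ˡ T c _)

  divDiff-[_] : ∀ s g → divDiff (s ∷ []) g ≡ g s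
  divDiff-[ s ] g = begin
    g s * (gap s s * 1ℚ) ⁻¹ + 0ℚ   ≡⟨ +-identityʳ _ ⟩
    g s * (gap s s * 1ℚ) ⁻¹        ≡⟨ cong (λ x → g s * (x * 1ℚ) ⁻¹) (gap-refl s) ⟩
    g s * 1ℚ                       ≡⟨ *-identityʳ (g s) ⟩
    g s                            ∎
    where open ≡-Reasoning

  divDiff-swap : ∀ a b R g → divDiff (a ∷ b ∷ R) g ≡ divDiff (b ∷ a ∷ R) g
  divDiff-swap a b R g = begin
    x a + (x b + sumOver R x)   ≡⟨ cong₂ (λ p q → p + (q + sumOver R x)) (x≡y a) (x≡y b) ⟩
    y a + (y b + sumOver R x)   ≡⟨ cong (λ z → y a + (y b + z)) (sumOver-cong R (λ {t} _ → x≡y t)) ⟩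
    y a + (y b + sumOver R y)   ≡⟨ solve 3 (λ p q r → p :+ (q :+ r) := q :+ (p :+ r)) refl (y a) (y b) _ ⟩
    y b + (y a + sumOver R y)   ∎
    where
    open ≡-Reasoning
    x y : ℚ → ℚ
    x t = g t * nodeProduct (a ∷ b ∷ R) t ⁻¹
    y t = g t * nodeProduct (b ∷ a ∷ R) t ⁻¹
    x≡y : ∀ t → x t ≡ y t
    x≡y t = cong (λ z → g t * z ⁻¹)
      (solve 3 (λ p q r → p :* (q :* r) := q :* (p :* r)) refl (gap a t) (gap b t) (nodeProduct R t))

  nodeProduct-∷ : ∀ {a t} R → a ≢ t → (t - a) * nodeProduct (a ∷ R) t ⁻¹ ≡ nodeProduct R t ⁻¹
  nodeProduct-∷ {a} {t} R a≢t = begin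
    (t - a) * (gap a t * N) ⁻¹            ≡⟨ cong (λ z → (t - a) * (z * N) ⁻¹) (gap-≢ a≢t) ⟩
    (t - a) * ((t - a) * N) ⁻¹            ≡⟨ cong ((t - a) *_) (⁻¹-distrib-* (t - a) N t-a≢0 (nodeProduct-≢0 R t)) ⟩
    (t - a) * ((t - a) ⁻¹ * N ⁻¹)         ≡⟨ sym (*-assoc (t - a) _ _) ⟩
    (t - a) * (t - a) ⁻¹ * N ⁻¹           ≡⟨ cong (_* N ⁻¹) (⁻¹-inverseʳ (t - a) t-a≢0) ⟩
    1ℚ * N ⁻¹                             ≡⟨ *-identityˡ _ ⟩
    N ⁻¹                                  ∎
    where
    open ≡-Reasoning
    N : ℚ
    N = nodeProduct R t
    t-a≢0 : t - a ≢ 0ℚ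
    t-a≢0 = p≢q⇒p-q≢0 (a≢t ∘ sym)

  divDiff-leibniz : ∀ a R g → All (a ≢_) R →
                    divDiff (a ∷ R) (λ t → t * g t) ≡ a * divDiff (a ∷ R) g + divDiff R g
  divDiff-leibniz a R g a∉R = begin
    a * g a * w a + sumOver R (λ t → t * g t * w t)
      ≡⟨ cong (a * g a * w a +_) (sumOver-cong R split) ⟩
    a * g a * w a + sumOver R (λ t → a * (g t * w t) + g t * nodeProduct R t ⁻¹)
      ≡⟨ cong (a * g a * w a +_) (sumOver-+ R _ _) ⟩
    a * g a * w a + (sumOver R (λ t → a * (g t * w t)) + divDiff R g)
      ≡⟨ cong (λ z → a * g a * w a + (z + divDiff R g)) (sumOver-*ˡ R a _) ⟩
    a * g a * w a + (a * sumOver R (λ t → g t * w t) + divDiff R g)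
      ≡⟨ solve 5 (λ a x y z s → a :* x :* y :+ (a :* s :+ z) := a :* (x :* y :+ s) :+ z)
           refl a (g a) (w a) (divDiff R g) (sumOver R (λ t → g t * w t)) ⟩
    a * (g a * w a + sumOver R (λ t → g t * w t)) + divDiff R g
      ∎
    where
    open ≡-Reasoning
    w : ℚ → ℚ
    w t = nodeProduct (a ∷ R) t ⁻¹
    split : ∀ {t} → t ∈ R → t * g t * w t ≡ a * (g t * w t) + g t * nodeProduct R t ⁻¹
    split {t} t∈R = begin
      t * g t * w t                         ≡⟨ solve 4 (λ t a g w → t :* g :* w := a :* (g :* w) :+ g :* ((t :- a) :* w))
                                                 refl t a (g t) (w t) ⟩
      a * (g t * w t) + g t * ((t - a) * w t) ≡⟨ cong (λ z → a * (g t * w t) + g t * z)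
                                                   (nodeProduct-∷ R (All.lookup a∉R t∈R)) ⟩
      a * (g t * w t) + g t * nodeProduct R t ⁻¹ ∎

  divDiff-recurrence : ∀ a b R g → Unique (a ∷ b ∷ R) →
                       (a - b) * divDiff (a ∷ b ∷ R) g ≡ divDiff (a ∷ R) g - divDiff (b ∷ R) g
  divDiff-recurrence a b R g ((a≢b ∷ a∉R) ∷ (b∉R ∷ _)) = begin
    (a - b) * D
      ≡⟨ solve 5 (λ a b D x y → (a :- b) :* D := ((a :* D :+ y) :- (b :* D :+ x)) :+ x :- y)
           refl a b D (divDiff (a ∷ R) g) (divDiff (b ∷ R) g) ⟩
    ((a * D + divDiff (b ∷ R) g) - (b * D + divDiff (a ∷ R) g)) + divDiff (a ∷ R) g - divDiff (b ∷ R) g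
      ≡⟨ cong₂ (λ p q → (p - q) + divDiff (a ∷ R) g - divDiff (b ∷ R) g) (sym viaA) (sym viaB) ⟩
    (X - X) + divDiff (a ∷ R) g - divDiff (b ∷ R) g
      ≡⟨ solve 3 (λ X x y → (X :- X) :+ x :- y := x :- y) refl X (divDiff (a ∷ R) g) (divDiff (b ∷ R) g) ⟩
    divDiff (a ∷ R) g - divDiff (b ∷ R) g
      ∎
    where
    open ≡-Reasoning
    D X : ℚ
    D = divDiff (a ∷ b ∷ R) g
    X = divDiff (a ∷ b ∷ R) (λ t → t * g t)
    viaA : X ≡ a * D + divDiff (b ∷ R) g
    viaA = divDiff-leibniz a (b ∷ R) g (a≢b ∷ a∉R)
    viaB : X ≡ b * D + divDiff (a ∷ R) g
    viaB = begin
      X                                          ≡⟨ divDiff-swap a b R (λ t → t * g t) ⟩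
      divDiff (b ∷ a ∷ R) (λ t → t * g t)        ≡⟨ divDiff-leibniz b (a ∷ R) g ((a≢b ∘ sym) ∷ b∉R) ⟩
      b * divDiff (b ∷ a ∷ R) g + divDiff (a ∷ R) g ≡⟨ cong (λ z → b * z + divDiff (a ∷ R) g) (divDiff-swap b a R g) ⟩
      b * D + divDiff (a ∷ R) g                  ∎

  divDiff-const : ∀ {a b R} K → Unique (a ∷ b ∷ R) → divDiff (a ∷ b ∷ R) (λ _ → K) ≡ 0ℚ
  divDiff-const {a} {b} {R} K abR-unique@((a≢b ∷ a∉R) ∷ (b∉R ∷ R-unique)) =
    p≢0∧p*q≡0⇒q≡0 (a - b) _ (p≢q⇒p-q≢0 a≢b)
      (trans (divDiff-recurrence a b R (λ _ → K) abR-unique) (tails-agree R a∉R b∉R R-unique))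
    where
    tails-agree : ∀ R → All (a ≢_) R → All (b ≢_) R → Unique R →
                  divDiff (a ∷ R) (λ _ → K) - divDiff (b ∷ R) (λ _ → K) ≡ 0ℚ
    tails-agree []      _ _ _ = trans (cong₂ _-_ (divDiff-[ a ] (λ _ → K)) (divDiff-[ b ] (λ _ → K))) (+-inverseʳ K)
    tails-agree (c ∷ R) a∉cR b∉cR cR-unique =
      cong₂ _-_ (divDiff-const K (a∉cR ∷ cR-unique)) (divDiff-const K (b∉cR ∷ cR-unique))

module Polynomial where

  open import Data.Nat.Base as ℕ using (ℕ; zero; suc; _<_)
  import Data.Nat.Properties as ℕ
  open import Algebra.Properties.Monoid.Sum ℕ.+-0-monoid using (sum)
  open import Data.Fin.Base using (Fin; zero; suc)
  open import Data.Vec.Functional using (Vector; head; tail) renaming (_∷_ to _∷ᵥ_)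
  open import Data.Rational.Base hiding (_<_; _≤_)
  open import Data.Rational.Properties
  open import Data.Rational.Solver using (module +-*-Solver)
  open import Data.List.Base using (List; []; _∷_; length)
  open import Data.List.Membership.Propositional using (_∈_)
  open import Data.List.Relation.Unary.Any using (here; there)
  open import Data.Product.Base using (_×_; _,_)
  open import Function.Base using (_∘_)
  open import Relation.Binary.PropositionalEquality
  open +-*-Solver
  open Rational

  -- Polynomials over ℚ in the variables x₀, …, x₍ₙ₋₁₎ of total degree at most D, in Horner form with
  -- respect to x₀: ↑ a does not involve x₀, and a +x₀* p stands for a + x₀ p.
  data Poly : ℕ → ℕ → Set where
    const   : ∀ {D} → ℚ → Poly 0 D
    ↑_      : ∀ {n D} → Poly n D → Poly (suc n) D
    _+x₀*_  : ∀ {n D} → Poly n (suc D) → Poly (suc n) D → Poly (suc n) (suc D)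

  eval : ∀ {n D} → Poly n D → Vector ℚ n → ℚ
  eval (const c)  x = c
  eval (↑ a)      x = eval a (tail x)
  eval (a +x₀* p) x = eval a (tail x) + head x * eval p x

  eval-cong : ∀ {n D} (P : Poly n D) {x y : Vector ℚ n} → x ≗ y → eval P x ≡ eval P y
  eval-cong (const c)  x≗y = refl
  eval-cong (↑ a)      x≗y = eval-cong a (x≗y ∘ suc)
  eval-cong (a +x₀* p) x≗y = cong₂ _+_ (eval-cong a (x≗y ∘ suc)) (cong₂ _*_ (x≗y zero) (eval-cong p x≗y))

  byExponent : ℕ → ℚ → (ℕ → ℚ) → ℚ
  byExponent zero    c₀ cₛ = c₀
  byExponent (suc i) c₀ cₛ = cₛ i

  byExponent-cong : ∀ {j j′ c₀ c₀′ cₛ cₛ′} → j ≡ j′ → c₀ ≡ c₀′ → (∀ i → cₛ i ≡ cₛ′ i) →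
                    byExponent j c₀ cₛ ≡ byExponent j′ c₀′ cₛ′
  byExponent-cong {zero}  refl c₀≡ cₛ≗ = c₀≡
  byExponent-cong {suc i} refl c₀≡ cₛ≗ = cₛ≗ i

  byExponent-≡0 : ∀ j {c₀ cₛ} → (j ≡ 0 → c₀ ≡ 0ℚ) → (∀ i → j ≡ suc i → cₛ i ≡ 0ℚ) →
                  byExponent j c₀ cₛ ≡ 0ℚ
  byExponent-≡0 zero    c₀≡0 cₛ≡0 = c₀≡0 refl
  byExponent-≡0 (suc i) c₀≡0 cₛ≡0 = cₛ≡0 i refl

  coeff : ∀ {n D} → Poly n D → Vector ℕ n → ℚ
  coeff (const c)  e = c
  coeff (↑ a)      e = byExponent (head e) (coeff a (tail e)) (λ _ → 0ℚ)
  coeff (a +x₀* p) e = byExponent (head e) (coeff a (tail e)) (λ i → coeff p (i ∷ᵥ tail e))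

  coeff-cong : ∀ {n D} (P : Poly n D) {e e′ : Vector ℕ n} → e ≗ e′ → coeff P e ≡ coeff P e′
  coeff-cong (const c)  e≗e′ = refl
  coeff-cong (↑ a)      e≗e′ = byExponent-cong (e≗e′ zero) (coeff-cong a (e≗e′ ∘ suc)) (λ _ → refl)
  coeff-cong (a +x₀* p) e≗e′ = byExponent-cong (e≗e′ zero) (coeff-cong a (e≗e′ ∘ suc))
    (λ i → coeff-cong p λ { zero → refl ; (suc v) → e≗e′ (suc v) })

  coeff-aboveDegree : ∀ {n D} (P : Poly n D) (e : Vector ℕ n) → D < sum e → coeff P e ≡ 0ℚ
  coeff-aboveDegree (const c) e ()
  coeff-aboveDegree (↑_ {D = D} a) e D<∑e = byExponent-≡0 (head e)
    (λ e₀≡0 → coeff-aboveDegree a (tail e) (subst (λ j → D < j ℕ.+ sum (tail e)) e₀≡0 D<∑e))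
    (λ _ _ → refl)
  coeff-aboveDegree (_+x₀*_ {D = D} a p) e D<∑e = byExponent-≡0 (head e)
    (λ e₀≡0 → coeff-aboveDegree a (tail e) (subst (λ j → suc D < j ℕ.+ sum (tail e)) e₀≡0 D<∑e))
    (λ i e₀≡1+i → coeff-aboveDegree p (i ∷ᵥ tail e)
                    (ℕ.≤-pred (subst (λ j → suc D < j ℕ.+ sum (tail e)) e₀≡1+i D<∑e)))

  0ₚ : ∀ {n D} → Poly n D
  0ₚ {zero}  = const 0ℚ
  0ₚ {suc n} = ↑ 0ₚ

  1ₚ : ∀ {n} → Poly n 0
  1ₚ {zero}  = const 1ℚ
  1ₚ {suc n} = ↑ 1ₚ

  infixl 6 _+ₚ_
  infixr 7 _·ₚ_ X_*ₚ_

  _+ₚ_ : ∀ {n D} → Poly n D → Poly n D → Poly n D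
  const a    +ₚ const b    = const (a + b)
  ↑ a        +ₚ ↑ b        = ↑ (a +ₚ b)
  ↑ a        +ₚ (b +x₀* q) = (a +ₚ b) +x₀* q
  (a +x₀* p) +ₚ ↑ b        = (a +ₚ b) +x₀* p
  (a +x₀* p) +ₚ (b +x₀* q) = (a +ₚ b) +x₀* (p +ₚ q)

  _·ₚ_ : ∀ {n D} → ℚ → Poly n D → Poly n D
  c ·ₚ const a    = const (c * a)
  c ·ₚ ↑ a        = ↑ (c ·ₚ a)
  c ·ₚ (a +x₀* p) = (c ·ₚ a) +x₀* (c ·ₚ p)

  X_*ₚ_ : ∀ {n D} → Fin n → Poly n D → Poly n (suc D)
  X zero  *ₚ P          = 0ₚ +x₀* P
  X suc u *ₚ ↑ a        = ↑ (X u *ₚ a)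
  X suc u *ₚ (a +x₀* p) = (X u *ₚ a) +x₀* (X suc u *ₚ p)

  eval-0ₚ : ∀ {n D} (x : Vector ℚ n) → eval (0ₚ {n} {D}) x ≡ 0ℚ
  eval-0ₚ {zero}  x = refl
  eval-0ₚ {suc n} x = eval-0ₚ (tail x)

  eval-1ₚ : ∀ {n} (x : Vector ℚ n) → eval (1ₚ {n}) x ≡ 1ℚ
  eval-1ₚ {zero}  x = refl
  eval-1ₚ {suc n} x = eval-1ₚ (tail x)

  eval-+ₚ : ∀ {n D} (P Q : Poly n D) x → eval (P +ₚ Q) x ≡ eval P x + eval Q x
  eval-+ₚ (const a)  (const b)  x = refl
  eval-+ₚ (↑ a)      (↑ b)      x = eval-+ₚ a b (tail x)
  eval-+ₚ (↑ a)      (b +x₀* q) x = trans (cong (_+ head x * eval q x) (eval-+ₚ a b (tail x)))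
    (solve 3 (λ a b c → (a :+ b) :+ c := a :+ (b :+ c)) refl (eval a (tail x)) (eval b (tail x)) _)
  eval-+ₚ (a +x₀* p) (↑ b)      x = trans (cong (_+ head x * eval p x) (eval-+ₚ a b (tail x)))
    (solve 3 (λ a b c → (a :+ b) :+ c := (a :+ c) :+ b) refl (eval a (tail x)) (eval b (tail x)) _)
  eval-+ₚ (a +x₀* p) (b +x₀* q) x =
    trans (cong₂ (λ s t → s + head x * t) (eval-+ₚ a b (tail x)) (eval-+ₚ p q x))
      (solve 5 (λ a b y p q → (a :+ b) :+ y :* (p :+ q) := (a :+ y :* p) :+ (b :+ y :* q))
         refl (eval a (tail x)) (eval b (tail x)) (head x) (eval p x) (eval q x))

  eval-·ₚ : ∀ {n D} c (P : Poly n D) x → eval (c ·ₚ P) x ≡ c * eval P x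
  eval-·ₚ c (const a)  x = refl
  eval-·ₚ c (↑ a)      x = eval-·ₚ c a (tail x)
  eval-·ₚ c (a +x₀* p) x = trans (cong₂ (λ s t → s + head x * t) (eval-·ₚ c a (tail x)) (eval-·ₚ c p x))
    (solve 4 (λ c a y p → c :* a :+ y :* (c :* p) := c :* (a :+ y :* p)) refl c (eval a (tail x)) (head x) (eval p x))

  eval-X*ₚ : ∀ {n D} u (P : Poly n D) x → eval (X u *ₚ P) x ≡ x u * eval P x
  eval-X*ₚ zero    P          x = trans (cong (_+ head x * eval P x) (eval-0ₚ (tail x))) (+-identityˡ _)
  eval-X*ₚ (suc u) (↑ a)      x = eval-X*ₚ u a (tail x)
  eval-X*ₚ (suc u) (a +x₀* p) x =
    trans (cong₂ (λ s t → s + head x * t) (eval-X*ₚ u a (tail x)) (eval-X*ₚ (suc u) p x))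
      (solve 4 (λ c a y p → c :* a :+ y :* (c :* p) := c :* (a :+ y :* p)) refl (x (suc u)) (eval a (tail x)) (head x) (eval p x))

  differenceProduct : ∀ {n} (l : List (Fin n × Fin n)) → Poly n (length l)
  differenceProduct []            = 1ₚ
  differenceProduct ((u , v) ∷ l) = X u *ₚ differenceProduct l +ₚ (- 1ℚ) ·ₚ X v *ₚ differenceProduct l

  eval-differenceProduct-∷ : ∀ {n} u v (l : List (Fin n × Fin n)) x →
    eval (differenceProduct ((u , v) ∷ l)) x ≡ (x u - x v) * eval (differenceProduct l) x
  eval-differenceProduct-∷ {n} u v l x = begin
    eval (X u *ₚ P +ₚ (- 1ℚ) ·ₚ X v *ₚ P) x              ≡⟨ eval-+ₚ (X u *ₚ P) _ x ⟩
    eval (X u *ₚ P) x + eval ((- 1ℚ) ·ₚ X v *ₚ P) x       ≡⟨ cong₂ _+_ (eval-X*ₚ u P x) (eval-·ₚ (- 1ℚ) (X v *ₚ P) x) ⟩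
    x u * eval P x + (- 1ℚ) * eval (X v *ₚ P) x          ≡⟨ cong (λ z → x u * eval P x + (- 1ℚ) * z) (eval-X*ₚ v P x) ⟩
    x u * eval P x + (- 1ℚ) * (x v * eval P x)           ≡⟨ solve 3 (λ a b p → a :* p :+ (:- con 1ℚ) :* (b :* p) := (a :- b) :* p)
                                                              refl (x u) (x v) (eval P x) ⟩
    (x u - x v) * eval P x                               ∎
    where
    open ≡-Reasoning
    P : Poly n (length l)
    P = differenceProduct l

  differenceProduct-≡0 : ∀ {n} (l : List (Fin n × Fin n)) x {u v} → (u , v) ∈ l → x u ≡ x v →
                         eval (differenceProduct l) x ≡ 0ℚ
  differenceProduct-≡0 ((u , v) ∷ l) x (here refl) xu≡xv = begin
    eval (differenceProduct ((u , v) ∷ l)) x    ≡⟨ eval-differenceProduct-∷ u v l x ⟩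
    (x u - x v) * eval (differenceProduct l) x  ≡⟨ cong (λ z → (z - x v) * eval (differenceProduct l) x) xu≡xv ⟩
    (x v - x v) * eval (differenceProduct l) x  ≡⟨ cong (_* eval (differenceProduct l) x) (+-inverseʳ (x v)) ⟩
    0ℚ * eval (differenceProduct l) x           ≡⟨ *-zeroˡ (eval (differenceProduct l) x) ⟩
    0ℚ                                          ∎
    where open ≡-Reasoning
  differenceProduct-≡0 ((u′ , v′) ∷ l) x (there uv∈l) xu≡xv =
    trans (eval-differenceProduct-∷ u′ v′ l x)
      (trans (cong ((x u′ - x v′) *_) (differenceProduct-≡0 l x uv∈l xu≡xv)) (*-zeroʳ (x u′ - x v′)))

  differenceProduct-≢0 : ∀ {n} (l : List (Fin n × Fin n)) x → (∀ {u v} → (u , v) ∈ l → x u ≢ x v) →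
                         eval (differenceProduct l) x ≢ 0ℚ
  differenceProduct-≢0 []            x _       = subst (_≢ 0ℚ) (sym (eval-1ₚ x)) 1≢0
  differenceProduct-≢0 ((u , v) ∷ l) x l-apart = subst (_≢ 0ℚ) (sym (eval-differenceProduct-∷ u v l x))
    (p≢0∧q≢0⇒p*q≢0 (p≢q⇒p-q≢0 (l-apart (here refl))) (differenceProduct-≢0 l x (l-apart ∘ there)))

module Nullstellensatz where

  open import Data.Nat.Base as ℕ using (ℕ; zero; suc; _<_; _≤_; _∸_; s≤s)
  import Data.Nat.Properties as ℕ
  open import Algebra.Properties.Monoid.Sum ℕ.+-0-monoid using (sum)
  open import Data.Fin.Base using (zero; suc)
  open import Data.Vec.Functional using (Vector; head; tail) renaming ([] to []ᵥ; _∷_ to _∷ᵥ_)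
  open import Data.Vec.Functional.Relation.Binary.Pointwise using (Pointwise)
  open import Data.Rational.Base hiding (_<_; _≤_)
  open import Data.Rational.Properties
  open import Data.Rational.Solver using (module +-*-Solver)
  open import Data.List.Base using (List; []; _∷_; length)
  open import Data.List.Membership.Propositional using (_∈_)
  open import Data.List.Relation.Unary.AllPairs using (_∷_)
  open import Data.List.Relation.Unary.Unique.Propositional using (Unique)
  open import Data.Product.Base using (∃-syntax; _,_)
  open import Function.Base using (_∘_)
  open import Relation.Binary.PropositionalEquality
  open +-*-Solver using (solve; _:=_; _:+_; _:*_; con)
  open Rational
  open DividedDifference
  open Polynomial

  -- The iterated divided difference over the grid S₀ × ⋯ × Sₙ₋₁, that is
  -- ∑_{x ∈ grid} h x / ∏ᵥ ∏_{s ∈ Sᵥ, s ≠ xᵥ} (xᵥ - s).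
  divDiffⁿ : ∀ {n} → Vector (List ℚ) n → (Vector ℚ n → ℚ) → ℚ
  divDiffⁿ {zero}  S h = h []ᵥ
  divDiffⁿ {suc n} S h = divDiff (head S) (λ t → divDiffⁿ (tail S) (λ y → h (t ∷ᵥ y)))

  divDiffⁿ-cong : ∀ {n} (S : Vector (List ℚ) n) {h₁ h₂} → h₁ ≗ h₂ → divDiffⁿ S h₁ ≡ divDiffⁿ S h₂
  divDiffⁿ-cong {zero}  S h₁≗h₂ = h₁≗h₂ []ᵥ
  divDiffⁿ-cong {suc n} S h₁≗h₂ = divDiff-cong (head S) (λ t → divDiffⁿ-cong (tail S) (h₁≗h₂ ∘ (t ∷ᵥ_)))

  divDiffⁿ-+ : ∀ {n} (S : Vector (List ℚ) n) h₁ h₂ →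
               divDiffⁿ S (λ y → h₁ y + h₂ y) ≡ divDiffⁿ S h₁ + divDiffⁿ S h₂
  divDiffⁿ-+ {zero}  S h₁ h₂ = refl
  divDiffⁿ-+ {suc n} S h₁ h₂ =
    trans (divDiff-cong (head S) (λ t → divDiffⁿ-+ (tail S) (h₁ ∘ (t ∷ᵥ_)) (h₂ ∘ (t ∷ᵥ_))))
          (divDiff-+ (head S) (λ t → divDiffⁿ (tail S) (h₁ ∘ (t ∷ᵥ_))) (λ t → divDiffⁿ (tail S) (h₂ ∘ (t ∷ᵥ_))))

  divDiffⁿ-*ˡ : ∀ {n} (S : Vector (List ℚ) n) c h → divDiffⁿ S (λ y → c * h y) ≡ c * divDiffⁿ S h
  divDiffⁿ-*ˡ {zero}  S c h = refl
  divDiffⁿ-*ˡ {suc n} S c h =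
    trans (divDiff-cong (head S) (λ t → divDiffⁿ-*ˡ (tail S) c (h ∘ (t ∷ᵥ_))))
          (divDiff-*ˡ (head S) c (λ t → divDiffⁿ (tail S) (h ∘ (t ∷ᵥ_))))

  divDiffⁿ-≡0 : ∀ {n} (S : Vector (List ℚ) n) h → (∀ y → Pointwise _∈_ y S → h y ≡ 0ℚ) → divDiffⁿ S h ≡ 0ℚ
  divDiffⁿ-≡0 {zero}  S h h≡0 = h≡0 []ᵥ (λ ())
  divDiffⁿ-≡0 {suc n} S h h≡0 = sumOver-≡0 (head S) _ λ {t} t∈S₀ →
    trans (cong (_* nodeProduct (head S) t ⁻¹)
                (divDiffⁿ-≡0 (tail S) (h ∘ (t ∷ᵥ_)) (λ y y∈S → h≡0 (t ∷ᵥ y) λ { zero → t∈S₀ ; (suc v) → y∈S v })))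
          (*-zeroˡ (nodeProduct (head S) t ⁻¹))

  divDiffⁿ-≢0 : ∀ {n} (S : Vector (List ℚ) n) h x → (∀ v → Unique (S v)) → (∀ {y z} → y ≗ z → h y ≡ h z) →
                Pointwise _∈_ x S → h x ≢ 0ℚ → (∀ y → Pointwise _∈_ y S → ∃[ v ] y v ≢ x v → h y ≡ 0ℚ) →
                divDiffⁿ S h ≢ 0ℚ
  divDiffⁿ-≢0 {zero}  S h x _ h-cong _ hx≢0 _ = hx≢0 ∘ trans (h-cong λ ())
  divDiffⁿ-≢0 {suc n} S h x S-unique h-cong x∈S hx≢0 h≡0 =
    subst (_≢ 0ℚ) (sym (sumOver-single (head S) _ (S-unique zero) (x∈S zero) off-x₀))
      (p≢0∧q≢0⇒p*q≢0 slice-x₀≢0 (⁻¹-≢0 _ (nodeProduct-≢0 (head S) (head x))))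
    where
    slice : ℚ → ℚ
    slice t = divDiffⁿ (tail S) (h ∘ (t ∷ᵥ_))
    off-x₀ : ∀ {t} → t ∈ head S → t ≢ head x → slice t * nodeProduct (head S) t ⁻¹ ≡ 0ℚ
    off-x₀ {t} t∈S₀ t≢x₀ = trans
      (cong (_* nodeProduct (head S) t ⁻¹) (divDiffⁿ-≡0 (tail S) (h ∘ (t ∷ᵥ_))
        (λ y y∈S → h≡0 (t ∷ᵥ y) (λ { zero → t∈S₀ ; (suc v) → y∈S v }) (zero , t≢x₀))))
      (*-zeroˡ (nodeProduct (head S) t ⁻¹))
    slice-x₀≢0 : slice (head x) ≢ 0ℚ
    slice-x₀≢0 = divDiffⁿ-≢0 (tail S) (h ∘ (head x ∷ᵥ_)) (tail x) (S-unique ∘ suc) h-cong′ (x∈S ∘ suc)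
      (hx≢0 ∘ trans (h-cong λ { zero → refl ; (suc v) → refl }))
      (λ { y y∈S (v , yᵥ≢xᵥ) → h≡0 (head x ∷ᵥ y) (λ { zero → x∈S zero ; (suc v) → y∈S v }) (suc v , yᵥ≢xᵥ) })
      where
      h-cong′ : ∀ {y z} → y ≗ z → h (head x ∷ᵥ y) ≡ h (head x ∷ᵥ z)
      h-cong′ y≗z = h-cong λ { zero → refl ; (suc v) → y≗z v }

  degrees : ∀ {n} → Vector (List ℚ) n → Vector ℕ n
  degrees S v = length (S v) ∸ 1

  divDiffⁿ-+x₀* : ∀ {n D} (a : Poly n (suc D)) (p : Poly (suc n) D) T (S : Vector (List ℚ) n) →
    divDiffⁿ (T ∷ᵥ S) (eval (a +x₀* p)) ≡
    divDiff T (λ _ → divDiffⁿ S (eval a)) + divDiff T (λ t → t * divDiffⁿ S (eval p ∘ (t ∷ᵥ_)))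
  divDiffⁿ-+x₀* a p T S = trans
    (divDiff-cong T λ t → trans (divDiffⁿ-+ S (eval a) (λ y → t * eval p (t ∷ᵥ y)))
                                (cong (divDiffⁿ S (eval a) +_) (divDiffⁿ-*ˡ S t (eval p ∘ (t ∷ᵥ_)))))
    (divDiff-+ T (λ _ → divDiffⁿ S (eval a)) (λ t → t * divDiffⁿ S (eval p ∘ (t ∷ᵥ_))))

  -- The coefficient formula of the Combinatorial Nullstellensatz (Lasoń; Karasev–Petrov).
  coefficient-formula : ∀ {n D} (P : Poly n D) (S : Vector (List ℚ) n) →
    (∀ v → Unique (S v)) → (∀ v → 1 ≤ length (S v)) → D ≤ sum (degrees S) →
    divDiffⁿ S (eval P) ≡ coeff P (degrees S)

  divDiffⁿ-aboveDegree : ∀ {n D} (P : Poly n D) (S : Vector (List ℚ) n) →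
    (∀ v → Unique (S v)) → (∀ v → 1 ≤ length (S v)) → D < sum (degrees S) → divDiffⁿ S (eval P) ≡ 0ℚ

  coefficient-formula-↑ : ∀ {n D} (a : Poly n D) T (S : Vector (List ℚ) n) →
    Unique T → (∀ v → Unique (S v)) → 1 ≤ length T → (∀ v → 1 ≤ length (S v)) →
    D ≤ (length T ∸ 1) ℕ.+ sum (degrees S) →
    divDiff T (λ _ → divDiffⁿ S (eval a)) ≡ byExponent (length T ∸ 1) (coeff a (degrees S)) (λ _ → 0ℚ)

  coefficient-formula-+x₀* : ∀ {n D} (a : Poly n (suc D)) (p : Poly (suc n) D) T (S : Vector (List ℚ) n) →
    Unique T → (∀ v → Unique (S v)) → 1 ≤ length T → (∀ v → 1 ≤ length (S v)) →
    suc D ≤ (length T ∸ 1) ℕ.+ sum (degrees S) →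
    divDiffⁿ (T ∷ᵥ S) (eval (a +x₀* p)) ≡
    byExponent (length T ∸ 1) (coeff a (degrees S)) (λ i → coeff p (i ∷ᵥ degrees S))

  coefficient-formula (const c)  S _        _          _   = refl
  coefficient-formula (↑ a)      S S-unique S-nonempty deg = coefficient-formula-↑ a (head S) (tail S)
    (S-unique zero) (S-unique ∘ suc) (S-nonempty zero) (S-nonempty ∘ suc) deg
  coefficient-formula (a +x₀* p) S S-unique S-nonempty deg = coefficient-formula-+x₀* a p (head S) (tail S)
    (S-unique zero) (S-unique ∘ suc) (S-nonempty zero) (S-nonempty ∘ suc) deg

  divDiffⁿ-aboveDegree P S S-unique S-nonempty deg =
    trans (coefficient-formula P S S-unique S-nonempty (ℕ.<⇒≤ deg)) (coeff-aboveDegree P (degrees S) deg)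

  coefficient-formula-↑ a (s ∷ [])    S _        S-unique _ S-nonempty deg =
    trans (divDiff-[ s ] _) (coefficient-formula a S S-unique S-nonempty deg)
  coefficient-formula-↑ a (s ∷ r ∷ R) S T-unique _        _ _          _   =
    divDiff-const (divDiffⁿ S (eval a)) T-unique

  coefficient-formula-+x₀* a p (s ∷ []) S T-unique S-unique _ S-nonempty deg = begin
    divDiffⁿ ((s ∷ []) ∷ᵥ S) (eval (a +x₀* p))                   ≡⟨ divDiffⁿ-+x₀* a p (s ∷ []) S ⟩
    divDiff (s ∷ []) (λ _ → K) + divDiff (s ∷ []) (λ t → t * G t) ≡⟨ cong₂ _+_ (divDiff-[ s ] (λ _ → K))
                                                                               (divDiff-[ s ] (λ t → t * G t)) ⟩
    K + s * G s                                                 ≡⟨ cong (λ z → K + s * z) G-s≡0 ⟩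
    K + s * 0ℚ                                                  ≡⟨ solve 2 (λ K s → K :+ s :* con 0ℚ := K) refl K s ⟩
    K                                                           ≡⟨ coefficient-formula a S S-unique S-nonempty deg ⟩
    coeff a (degrees S)                                         ∎
    where
    open ≡-Reasoning
    K : ℚ
    K = divDiffⁿ S (eval a)
    G : ℚ → ℚ
    G t = divDiffⁿ S (eval p ∘ (t ∷ᵥ_))
    G-s≡0 : G s ≡ 0ℚ
    G-s≡0 = trans (sym (divDiff-[ s ] G))
      (divDiffⁿ-aboveDegree p ((s ∷ []) ∷ᵥ S) (λ { zero → T-unique ; (suc v) → S-unique v })
                            (λ { zero → s≤s ℕ.z≤n ; (suc v) → S-nonempty v }) deg)
  coefficient-formula-+x₀* a p (s ∷ r ∷ R) S T-unique@(s∉rR ∷ rR-unique) S-unique _ S-nonempty deg = begin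
    divDiffⁿ (T ∷ᵥ S) (eval (a +x₀* p))                  ≡⟨ divDiffⁿ-+x₀* a p T S ⟩
    divDiff T (λ _ → K) + divDiff T (λ t → t * G t)      ≡⟨ cong₂ _+_ (divDiff-const K T-unique)
                                                              (divDiff-leibniz s (r ∷ R) G s∉rR) ⟩
    0ℚ + (s * divDiff T G + divDiff (r ∷ R) G)           ≡⟨ cong (λ z → 0ℚ + (s * z + divDiff (r ∷ R) G)) top≡0 ⟩
    0ℚ + (s * 0ℚ + divDiff (r ∷ R) G)                    ≡⟨ solve 2 (λ s X → con 0ℚ :+ (s :* con 0ℚ :+ X) := X)
                                                              refl s (divDiff (r ∷ R) G) ⟩
    divDiffⁿ ((r ∷ R) ∷ᵥ S) (eval p)                     ≡⟨ coefficient-formula p ((r ∷ R) ∷ᵥ S)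
                                                              (λ { zero → rR-unique ; (suc v) → S-unique v })
                                                              (λ { zero → s≤s ℕ.z≤n ; (suc v) → S-nonempty v })
                                                              (ℕ.≤-pred deg) ⟩
    coeff p (degrees ((r ∷ R) ∷ᵥ S))                     ≡⟨ coeff-cong p (λ { zero → refl ; (suc v) → refl }) ⟩
    coeff p (length R ∷ᵥ degrees S)                      ∎
    where
    open ≡-Reasoning
    T : List ℚ
    T = s ∷ r ∷ R
    K : ℚ
    K = divDiffⁿ S (eval a)
    G : ℚ → ℚ
    G t = divDiffⁿ S (eval p ∘ (t ∷ᵥ_))
    top≡0 : divDiff T G ≡ 0ℚ
    top≡0 = divDiffⁿ-aboveDegree p (T ∷ᵥ S) (λ { zero → T-unique ; (suc v) → S-unique v })
                                 (λ { zero → s≤s ℕ.z≤n ; (suc v) → S-nonempty v }) deg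

module VectorSum where

  open import Data.Nat.Base using (ℕ; zero; suc; _*_; _≤_; z≤n)
  import Data.Nat.Properties as ℕ
  open import Algebra.Properties.Monoid.Sum ℕ.+-0-monoid using (sum)
  open import Data.Vec.Functional using (Vector; head; tail)
  open import Data.Fin.Base using (zero; suc)
  open import Function.Base using (_∘_)
  open import Relation.Binary.PropositionalEquality

  sum-≥ : ∀ {n} (f : Vector ℕ n) {c} → (∀ v → c ≤ f v) → n * c ≤ sum f
  sum-≥ {zero}  f c≤f = z≤n
  sum-≥ {suc n} f c≤f = ℕ.+-mono-≤ (c≤f zero) (sum-≥ (tail f) (c≤f ∘ suc))

  sum-tight : ∀ {n} (f : Vector ℕ n) {c} → (∀ v → c ≤ f v) → sum f ≤ n * c → ∀ v → f v ≡ c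
  sum-tight {suc n} f {c} c≤f ∑f≤ = λ
    { zero    → ℕ.≤-antisym f₀≤c (c≤f zero)
    ; (suc v) → sum-tight (tail f) (c≤f ∘ suc) ∑tail≤ v
    }
    where
    f₀≤c : head f ≤ c
    f₀≤c = ℕ.+-cancelʳ-≤ (n * c) (head f) c (ℕ.≤-trans (ℕ.+-monoʳ-≤ (head f) (sum-≥ (tail f) (c≤f ∘ suc))) ∑f≤)
    ∑tail≤ : sum (tail f) ≤ n * c
    ∑tail≤ = ℕ.+-cancelˡ-≤ c (sum (tail f)) (n * c) (ℕ.≤-trans (ℕ.+-monoˡ-≤ (sum (tail f)) (c≤f zero)) ∑f≤)

module Grid where

  open import Data.Nat.Base using (zero; suc)
  open import Data.Fin.Base using (zero; suc)
  open import Data.Vec.Functional using (Vector; head; tail) renaming ([] to []ᵥ; _∷_ to _∷ᵥ_)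
  open import Data.Vec.Functional.Relation.Binary.Pointwise using (Pointwise)
  open import Data.List.Base using (List; []; _∷_; map; concatMap)
  open import Data.List.Membership.Propositional using (_∈_; find; lose)
  open import Data.List.Membership.Propositional.Properties using (∈-map⁻; ∈-map⁺; ∈-concatMap⁻; ∈-concatMap⁺)
  open import Data.List.Relation.Unary.Any using (here; any?)
  open import Data.Product.Base using (∃-syntax; _×_; _,_; proj₁; proj₂)
  open import Function.Base using (_∘_)
  open import Relation.Binary.PropositionalEquality
  open import Relation.Nullary using (Dec; yes; no)

  choices : ∀ {n} {A : Set} → Vector (List A) n → List (Vector A n)
  choices {zero}  S = []ᵥ ∷ []
  choices {suc n} S = concatMap (λ t → map (t ∷ᵥ_) (choices (tail S))) (head S)

  ∈-choices⁻ : ∀ {n} {A : Set} (S : Vector (List A) n) {c} → c ∈ choices S → Pointwise _∈_ c S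
  ∈-choices⁻ {suc n} S c∈ v with find (∈-concatMap⁻ (λ t → map (t ∷ᵥ_) (choices (tail S))) {xs = head S} c∈)
  ... | t , t∈S₀ , c∈t∷ with ∈-map⁻ (t ∷ᵥ_) c∈t∷
  ... | c′ , c′∈ , refl with v
  ... | zero  = t∈S₀
  ... | suc v = ∈-choices⁻ (tail S) c′∈ v

  ∈-choices⁺ : ∀ {n} {A : Set} (S : Vector (List A) n) {c} → Pointwise _∈_ c S →
               ∃[ c′ ] c′ ∈ choices S × c′ ≗ c
  ∈-choices⁺ {zero}  S c∈S = []ᵥ , here refl , λ ()
  ∈-choices⁺ {suc n} S {c} c∈S with ∈-choices⁺ (tail S) (c∈S ∘ suc)
  ... | c′ , c′∈ , c′≗ = head c ∷ᵥ c′ ,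
      ∈-concatMap⁺ (λ t → map (t ∷ᵥ_) (choices (tail S))) (lose (c∈S zero) (∈-map⁺ (head c ∷ᵥ_) c′∈)) ,
      λ { zero → refl ; (suc v) → c′≗ v }

  ∃-choice? : ∀ {n} {A : Set} (S : Vector (List A) n) {Q : Vector A n → Set} →
           (∀ c → Dec (Q c)) → (∀ {c c′} → c ≗ c′ → Q c → Q c′) →
           Dec (∃[ c ] Pointwise _∈_ c S × Q c)
  ∃-choice? S Q? Q-resp with any? Q? (choices S)
  ... | yes found = let c , c∈ , Qc = find found in yes (c , ∈-choices⁻ S c∈ , Qc)
  ... | no none   = no λ { (c , c∈S , Qc) → let c′ , c′∈ , c′≗c = ∈-choices⁺ S c∈S in
                                             none (lose c′∈ (Q-resp (sym ∘ c′≗c) Qc)) }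

  ∈-grid-map⁻ : ∀ {n} {A B : Set} (f : A → B) (L : Vector (List A) n) {y} → Pointwise _∈_ y (map f ∘ L) →
                ∃[ c ] Pointwise _∈_ c L × y ≗ f ∘ c
  ∈-grid-map⁻ f L y∈ = (λ v → proj₁ (∈-map⁻ f (y∈ v))) , (λ v → proj₁ (proj₂ (∈-map⁻ f (y∈ v))))
                                                       , (λ v → proj₂ (proj₂ (∈-map⁻ f (y∈ v))))

module Colouring where

  open import Defs hiding (sym)
  open import Data.Nat.Base as ℕ using (_+_; _<ᵇ_)
  import Data.Nat.Properties as ℕ
  open import Data.Nat.ListAction using (sum)
  open import Data.Bool.Base using (Bool; true; false; if_then_else_; _∧_)
  import Data.Bool.Properties as Bool
  open import Data.Fin.Base using (Fin; toℕ)
  import Data.Fin.Properties as Fin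
  open import Data.Vec.Functional using (Vector)
  open import Data.List.Base using (List; []; _∷_; length; map; concatMap; allFin)
  import Data.List.Properties as List
  open import Data.List.Membership.Propositional using (_∈_; find; lose)
  open import Data.List.Membership.Propositional.Properties using (∈-concatMap⁻; ∈-concatMap⁺; ∈-allFin)
  open import Data.List.Relation.Unary.Any using (here)
  open import Data.Product.Base using (_×_; _,_; proj₂)
  open import Data.Rational.Base using (0ℚ)
  open import Function.Base using (_∘_)
  open import Function.Definitions using (Injective)
  open import Data.Empty using (⊥-elim)
  open import Function.Bundles using (Equivalence)
  open import Relation.Binary.Definitions using (DecidableEquality; tri<; tri≈; tri>)
  open import Relation.Binary.PropositionalEquality
  open import Relation.Nullary using (Dec)
  open import Relation.Nullary.Decidable using (_→-dec_; ¬?)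
  open Polynomial using (Poly; eval; differenceProduct; differenceProduct-≡0; differenceProduct-≢0)

  Proper : ∀ {n} {A : Set} → Graph n → Vector A n → Set
  Proper G c = ∀ u v → Adj G u v → c u ≢ c v

  Proper-resp-≗ : ∀ {n} {A : Set} (G : Graph n) {c c′ : Vector A n} → c ≗ c′ → Proper G c → Proper G c′
  Proper-resp-≗ G c≗c′ c-proper u v uv cu′≡cv′ = c-proper u v uv (trans (c≗c′ u) (trans cu′≡cv′ (sym (c≗c′ v))))

  Proper-∘⁻ : ∀ {n} {A B : Set} (G : Graph n) (f : A → B) {c : Fin n → A} → Proper G (f ∘ c) → Proper G c
  Proper-∘⁻ G f fc-proper u v uv cu≡cv = fc-proper u v uv (cong f cu≡cv)

  Proper-∘⁺ : ∀ {n} {A B : Set} (G : Graph n) {f : A → B} → Injective _≡_ _≡_ f → {c : Fin n → A} →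
              Proper G c → Proper G (f ∘ c)
  Proper-∘⁺ G f-injective c-proper u v uv = c-proper u v uv ∘ f-injective

  proper? : ∀ {n} {A : Set} → DecidableEquality A → (G : Graph n) (c : Vector A n) → Dec (Proper G c)
  proper? _≟_ G c = Fin.all? λ u → Fin.all? λ v → (adj G u v Bool.≟ true) →-dec ¬? (c u ≟ c v)

  Adj⇒≢ : ∀ {n} (G : Graph n) {u v} → Adj G u v → u ≢ v
  Adj⇒≢ G {u} uu refl with () ← trans (sym uu) (irrefl G u)

  length-concatMap : ∀ {A B : Set} (f : A → List B) xs → length (concatMap f xs) ≡ sum (map (length ∘ f) xs)
  length-concatMap f []       = refl
  length-concatMap f (x ∷ xs) = trans (List.length-++ (f x)) (cong (length (f x) +_) (length-concatMap f xs))

  module GraphPolynomial {n} (G : Graph n) where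

    forwardAdj : Fin n → Fin n → Bool
    forwardAdj u v = (toℕ u <ᵇ toℕ v) ∧ adj G u v

    edgeAt : Fin n → Fin n → List (Fin n × Fin n)
    edgeAt u v = if forwardAdj u v then (u , v) ∷ [] else []

    row : Fin n → List (Fin n × Fin n)
    row u = concatMap (edgeAt u) (allFin n)

    edges : List (Fin n × Fin n)
    edges = concatMap row (allFin n)

    length-edgeAt : ∀ u v → length (edgeAt u v) ≡ (if forwardAdj u v then 1 else 0)
    length-edgeAt u v with forwardAdj u v
    ... | true  = refl
    ... | false = refl

    length-edges : length edges ≡ edgeCount G
    length-edges = begin
      length edges                                    ≡⟨ length-concatMap row (allFin n) ⟩
      sum (map (length ∘ row) (allFin n))             ≡⟨ cong sum (List.map-cong length-row (allFin n)) ⟩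
      edgeCount G                                     ∎
      where
      open ≡-Reasoning
      length-row : ∀ u → length (row u) ≡ sum (map (λ v → if forwardAdj u v then 1 else 0) (allFin n))
      length-row u = trans (length-concatMap (edgeAt u) (allFin n)) (cong sum (List.map-cong (length-edgeAt u) (allFin n)))

    ∈-edgeAt⁻ : ∀ {u v e} → e ∈ edgeAt u v → e ≡ (u , v) × forwardAdj u v ≡ true
    ∈-edgeAt⁻ {u} {v} e∈ with forwardAdj u v in uv
    ∈-edgeAt⁻ (here e≡uv) | true = e≡uv , refl

    ∈-edgeAt⁺ : ∀ {u v} → forwardAdj u v ≡ true → (u , v) ∈ edgeAt u v
    ∈-edgeAt⁺ uv rewrite uv = here refl

    ∈-edges⁻ : ∀ {a b} → (a , b) ∈ edges → Adj G a b
    ∈-edges⁻ ab∈ with find (∈-concatMap⁻ row {xs = allFin n} ab∈)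
    ... | u , _ , ab∈row with find (∈-concatMap⁻ (edgeAt u) {xs = allFin n} ab∈row)
    ... | v , _ , ab∈uv with ∈-edgeAt⁻ ab∈uv
    ... | refl , uv = Equivalence.to Bool.T-≡ (proj₂ (Equivalence.to Bool.T-∧ (Equivalence.from Bool.T-≡ uv)))

    ∈-edges⁺ : ∀ {a b} → toℕ a ℕ.< toℕ b → Adj G a b → (a , b) ∈ edges
    ∈-edges⁺ {a} {b} a<b ab = ∈-concatMap⁺ row (lose (∈-allFin a)
      (∈-concatMap⁺ (edgeAt a) (lose (∈-allFin b) (∈-edgeAt⁺ (cong₂ _∧_ (Equivalence.to Bool.T-≡ (ℕ.<⇒<ᵇ a<b)) ab)))))

    graphPoly : Poly n (length edges)
    graphPoly = differenceProduct edges

    graphPoly-≡0 : ∀ x {u v} → Adj G u v → x u ≡ x v → eval graphPoly x ≡ 0ℚ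
    graphPoly-≡0 x {u} {v} uv xu≡xv with Fin.<-cmp u v
    ... | tri< u<v _ _ = differenceProduct-≡0 edges x (∈-edges⁺ u<v uv) xu≡xv
    ... | tri≈ _ u≡v _ = ⊥-elim (Adj⇒≢ G uv u≡v)
    ... | tri> _ _ v<u = differenceProduct-≡0 edges x (∈-edges⁺ v<u (trans (Graph.sym G v u) uv)) (sym xu≡xv)

    graphPoly≢0⇒Proper : ∀ x → eval graphPoly x ≢ 0ℚ → Proper G x
    graphPoly≢0⇒Proper x P≢0 u v uv xu≡xv = P≢0 (graphPoly-≡0 x uv xu≡xv)

    Proper⇒graphPoly≢0 : ∀ x → Proper G x → eval graphPoly x ≢ 0ℚ
    Proper⇒graphPoly≢0 x x-proper = differenceProduct-≢0 edges x (λ uv∈ → x-proper _ _ (∈-edges⁻ uv∈))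

module Sublists where

  open import Defs hiding (sym)
  open import Data.Nat.Base as ℕ using (ℕ; suc; _≤_; _<_; s≤s)
  import Data.Nat.Properties as ℕ
  open import Data.Fin.Base using (Fin)
  import Data.Fin.Properties as Fin
  open import Data.Vec.Functional using (Vector; updateAt)
  open import Data.Vec.Functional.Properties using (updateAt-updates; updateAt-minimal)
  open import Data.List.Base using (List; _∷_; length; take)
  import Data.List.Properties as List
  open import Data.List.Membership.Propositional using (_∈_)
  open import Data.List.Membership.Propositional.Properties using (∈-++⁺ˡ)
  open import Data.List.Membership.DecPropositional ℕ._≟_ using (_∈?_)
  open import Data.List.Relation.Binary.Subset.Propositional using (_⊆_)
  open import Data.List.Relation.Unary.Any using (here; there)
  open import Data.List.Relation.Unary.AllPairs using (_∷_)
  open import Data.List.Relation.Unary.Unique.Propositional using (Unique)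
  import Data.List.Relation.Unary.Unique.Propositional.Properties as Unique
  open import Data.List.Relation.Unary.All.Properties using (All¬⇒¬Any)
  open import Data.Product.Base using (∃-syntax; _×_; _,_; proj₁; proj₂)
  open import Function.Base using (_∘_; const; id)
  open import Function.Bundles using (_⇔_; Equivalence)
  open import Relation.Binary.PropositionalEquality
  open import Relation.Nullary using (¬_; yes; no)

  SameElements : List ℕ → List ℕ → Set
  SameElements A B = ∀ c → (c ∈ A) ⇔ (c ∈ B)

  take-⊆ : ∀ m (l : List ℕ) → take m l ⊆ l
  take-⊆ m l c∈ = subst (_ ∈_) (List.take++drop≡id m l) (∈-++⁺ˡ c∈)

  length-take-≤ : ∀ {m} (l : List ℕ) → m ≤ length l → length (take m l) ≡ m
  length-take-≤ {m} l m≤ = trans (List.length-take m l) (ℕ.m≤n⇒m⊓n≡m m≤)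

  -- B is the first or the second window of length m + 1 in l, according as the head of l lies outside or inside A.
  sublist-≉ : ∀ m (A l : List ℕ) → Unique l → suc m < length l →
              ∃[ B ] (Unique B × length B ≡ suc m × B ⊆ l) × ¬ SameElements A B
  sublist-≉ m A (x ∷ l) (x∉l ∷ l-unique) (s≤s m<) with x ∈? A
  ... | yes x∈A = take (suc m) l ,
        (Unique.take⁺ (suc m) l-unique , length-take-≤ l m< , there ∘ take-⊆ (suc m) l) ,
        λ A≈B → All¬⇒¬Any x∉l (take-⊆ (suc m) l (Equivalence.to (A≈B x) x∈A))
  ... | no x∉A = take (suc m) (x ∷ l) ,
        (Unique.take⁺ (suc m) (x∉l ∷ l-unique) , cong suc (length-take-≤ l (ℕ.<⇒≤ m<)) , take-⊆ (suc m) (x ∷ l)) ,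
        λ A≈B → x∉A (Equivalence.from (A≈B x) (here refl))

  updateAt-∀ : ∀ {n} {A : Set} (P : Fin n → A → Set) (xs : Vector A n) i f →
               (∀ j → j ≢ i → P j (xs j)) → P i (f (xs i)) → ∀ j → P j (updateAt xs i f j)
  updateAt-∀ P xs i f P-elsewhere P-at-i j with j Fin.≟ i
  ... | yes refl = subst (P i) (sym (updateAt-updates i xs)) P-at-i
  ... | no j≢i   = subst (P j) (sym (updateAt-minimal j i xs j≢i)) (P-elsewhere j j≢i)

  -- L′ truncates every list to length m + 1, except at a vertex v with a longer list, where it takes a
  -- window differing from the truncated list at some other vertex u.
  nonConstant-subassignment : ∀ {n} m (L : ListAssignment n) → WellFormed L → (∀ v → suc m ≤ length (L v)) →
    (∀ v → ∃[ u ] u ≢ v) → ¬ (IsAssignment (suc m) L × Constant L) →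
    ∃[ L′ ] IsAssignment (suc m) L′ × ¬ Constant L′ × (∀ v → L′ v ⊆ L v)
  nonConstant-subassignment {n} m L L-unique L-long other L-nonconst
    with Fin.all? (λ v → length (L v) ℕ.≟ suc m)
  ... | yes L-exact = L , (L-unique , L-exact) , (λ L-const → L-nonconst ((L-unique , L-exact) , L-const)) , λ _ → id
  ... | no L-inexact
    with v , |Lv|≢1+m ← Fin.¬∀⟶∃¬ _ _ (λ v → length (L v) ℕ.≟ suc m) L-inexact
    with u , u≢v ← other v
    with B , B-good , A≉B ← sublist-≉ m (take (suc m) (L u)) (L v) (L-unique v) (ℕ.≤∧≢⇒< (L-long v) (|Lv|≢1+m ∘ sym))
    = L′ , (proj₁ ∘ L′-good , proj₁ ∘ proj₂ ∘ L′-good) , L′-nonconst , proj₂ ∘ proj₂ ∘ L′-good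
    where
    L′ : ListAssignment n
    L′ = updateAt (λ w → take (suc m) (L w)) v (const B)
    Good : Fin n → List ℕ → Set
    Good w B = Unique B × length B ≡ suc m × B ⊆ L w
    L′-good : ∀ w → Good w (L′ w)
    L′-good = updateAt-∀ Good _ v _
      (λ w _ → Unique.take⁺ (suc m) (L-unique w) , length-take-≤ (L w) (L-long w) , take-⊆ (suc m) (L w))
      B-good
    L′-nonconst : ¬ Constant L′
    L′-nonconst L′-const = A≉B λ c →
      subst₂ (λ X Y → (c ∈ X) ⇔ (c ∈ Y)) (updateAt-minimal u v _ u≢v) (updateAt-updates v _) (L′-const u v c)

open import Defs hiding (sym)
open import Data.Nat.Base as ℕ using (ℕ; zero; suc; _*_; _∸_; _≤_; z≤n; s≤s)
import Data.Nat.Properties as ℕ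
open import Algebra.Properties.Monoid.Sum ℕ.+-0-monoid using (sum)
open import Data.Bool.Base using (true)
import Data.Bool.Properties as Bool
open import Data.Fin.Base using (Fin; zero; fromℕ<)
import Data.Fin.Properties as Fin
open import Data.Vec.Functional.Relation.Binary.Pointwise using (Pointwise)
open import Data.List.Base using (List; length; map; upTo)
import Data.List.Properties as List
open import Data.List.Membership.Propositional using (_∈_)
open import Data.List.Membership.Propositional.Properties using (∈-map⁺; ∈-upTo⁻)
open import Data.List.Relation.Binary.Subset.Propositional using (_⊆_)
open import Data.List.Relation.Unary.Unique.Propositional using (Unique)
import Data.List.Relation.Unary.Unique.Propositional.Properties as Unique
open import Data.Product.Base using (Σ; ∃-syntax; _×_; _,_; proj₁)
open import Data.Rational.Base using (ℚ; 0ℚ)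
import Data.Rational.Properties as ℚ
open import Data.Empty using (⊥-elim)
open import Function.Base using (_∘_)
open import Relation.Binary.PropositionalEquality
open import Relation.Nullary using (Dec; yes; no; ¬_)
open import Relation.Nullary.Decidable using (_×-dec_; ¬?; decidable-stable)
open Rational using (fromℕ; fromℕ-injective)
open Polynomial using (eval; eval-cong; coeff; coeff-cong; coeff-aboveDegree)
open Nullstellensatz
open Grid
open Colouring
open Sublists
open VectorSum

LColorable? : ∀ {n} (G : Graph n) L → Dec (LColorable G L)
LColorable? G L = ∃-choice? L (proper? ℕ._≟_ G) (Proper-resp-≗ G)

LColorable-⊆ : ∀ {n} (G : Graph n) {L L′ : ListAssignment n} → (∀ v → L′ v ⊆ L v) →
               LColorable G L′ → LColorable G L
LColorable-⊆ G L′⊆L (f , f∈L′ , f-proper) = f , (λ v → L′⊆L v (f∈L′ v)) , f-proper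

Edge : ∀ {n} → Graph n → Set
Edge G = ∃[ a ] ∃[ b ] Adj G a b

ChromaticNumber⇒Edge : ∀ {n} (G : Graph n) {m} → ChromaticNumber G (suc (suc m)) → Edge G
ChromaticNumber⇒Edge G (_ , not-colourable) with Fin.any? (λ a → Fin.any? (λ b → adj G a b Bool.≟ true))
... | yes ab   = ab
... | no no-ab = ⊥-elim (not-colourable ((λ _ → zero) , λ u v uv _ → no-ab (u , v , uv)))

otherVertex : ∀ {n} (G : Graph n) → Edge G → ∀ v → ∃[ u ] u ≢ v
otherVertex G (a , b , ab) v with v Fin.≟ a
... | yes refl = b , Adj⇒≢ G ab ∘ sym
... | no  v≢a  = a , v≢a ∘ sym

LColorable-nonConstant : ∀ {n} (G : Graph n) {m} → StrongChromaticChoosable G (suc (suc m)) →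
  (L : ListAssignment n) → WellFormed L → (∀ v → suc m ≤ length (L v)) →
  ¬ (IsAssignment (suc m) L × Constant L) → LColorable G L
LColorable-nonConstant G {m} (χ≡ , choosable) L L-unique L-long L-nonconst
  with nonConstant-subassignment m L L-unique L-long (otherVertex G (ChromaticNumber⇒Edge G χ≡)) L-nonconst
... | L′ , L′-assign , L′-nonconst , L′⊆L with LColorable? G L′
...   | yes L′-colourable = LColorable-⊆ G L′⊆L L′-colourable
...   | no  L′-uncolourable = ⊥-elim (L′-nonconst (choosable L′ L′-assign L′-uncolourable))

colours : ℕ → List ℚ
colours m = map fromℕ (upTo m)

length-colours : ∀ m → length (colours m) ≡ m
length-colours m = trans (List.length-map fromℕ (upTo m)) (List.length-upTo m)

module _ {n} (G : Graph n) where

  open GraphPolynomial G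

  divDiffⁿ-graphPoly-colours : ∀ m → ¬ Σ (Fin n → Fin m) (ProperColoring G m) →
                               divDiffⁿ (λ _ → colours m) (eval graphPoly) ≡ 0ℚ
  divDiffⁿ-graphPoly-colours m not-colourable = divDiffⁿ-≡0 _ (eval graphPoly) λ y y∈ →
    decidable-stable (eval graphPoly y ℚ.≟ 0ℚ) λ P≢0 →
      let c , c<m , y≡c = ∈-grid-map⁻ fromℕ (λ _ → upTo m) y∈
          colour : Fin n → Fin m
          colour v = fromℕ< (∈-upTo⁻ (c<m v))
      in not-colourable (colour , λ u v uv cu≡cv →
           graphPoly≢0⇒Proper y P≢0 u v uv
             (trans (y≡c u) (trans (cong fromℕ (Fin.fromℕ<-injective _ _ _ _ cu≡cv)) (sym (y≡c v)))))

  coeff-graphPoly≡0 : ∀ {m} → ¬ Σ (Fin n → Fin (suc m)) (ProperColoring G (suc m)) → length edges ≤ n * m →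
                      (d : Fin n → ℕ) → (∀ v → m ≤ d v) → coeff graphPoly d ≡ 0ℚ
  coeff-graphPoly≡0 {m} not-colourable e≤nm d m≤d with length edges ℕ.<? sum d
  ... | yes e<∑d = coeff-aboveDegree graphPoly d e<∑d
  ... | no  e≮∑d = begin
    coeff graphPoly d                   ≡⟨ coeff-cong graphPoly (λ v → trans (d≡m v) (sym (C-degree v))) ⟩
    coeff graphPoly (degrees C)         ≡⟨ sym (coefficient-formula graphPoly C C-unique C-nonempty
                                                 (ℕ.≤-trans e≤nm (sum-≥ (degrees C) (ℕ.≤-reflexive ∘ sym ∘ C-degree)))) ⟩
    divDiffⁿ C (eval graphPoly)         ≡⟨ divDiffⁿ-graphPoly-colours (suc m) not-colourable ⟩
    0ℚ                                  ∎
    where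
    open ≡-Reasoning
    C : Fin n → List ℚ
    C _ = colours (suc m)
    C-degree : ∀ v → degrees C v ≡ m
    C-degree _ = cong (_∸ 1) (length-colours (suc m))
    C-unique : ∀ v → Unique (C v)
    C-unique _ = Unique.map⁺ fromℕ-injective (Unique.upTo⁺ (suc m))
    C-nonempty : ∀ v → 1 ≤ length (C v)
    C-nonempty _ = subst (1 ≤_) (sym (length-colours (suc m))) (s≤s z≤n)
    d≡m : ∀ v → d v ≡ m
    d≡m = sum-tight d m≤d (ℕ.≤-trans (ℕ.≮⇒≥ e≮∑d) e≤nm)

  OtherLColouring : ListAssignment n → (Fin n → ℕ) → Set
  OtherLColouring L f = ∃[ g ] Pointwise _∈_ g L × Proper G g × ∃[ v ] g v ≢ f v

  OtherLColouring? : ∀ L f → Dec (OtherLColouring L f)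
  OtherLColouring? L f = ∃-choice? L (λ g → proper? ℕ._≟_ G g ×-dec Fin.any? (λ v → ¬? (g v ℕ.≟ f v)))
    λ g≗g′ (g-proper , v , gv≢fv) → Proper-resp-≗ G g≗g′ g-proper , v , gv≢fv ∘ trans (g≗g′ v)

  ¬¬OtherLColouring : ∀ {m} → ChromaticNumber G (suc (suc m)) → edgeCount G ≤ n * m →
    (L : ListAssignment n) → WellFormed L → (∀ v → suc m ≤ length (L v)) →
    ∀ f → ProperLColoring G L f → ¬ ¬ OtherLColouring L f
  ¬¬OtherLColouring {m} (_ , not-colourable) e≤nm L L-unique L-long f (f∈L , f-proper) no-other =
    divDiffⁿ-≢0 S h (fromℕ ∘ f) S-unique (eval-cong graphPoly) (∈-map⁺ fromℕ ∘ f∈L)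
      (Proper⇒graphPoly≢0 _ (Proper-∘⁺ G fromℕ-injective f-proper)) elsewhere≡0
      (begin
        divDiffⁿ S h                  ≡⟨ coefficient-formula graphPoly S S-unique S-nonempty
                                             (ℕ.≤-trans e≤ (sum-≥ (degrees S) m≤degree)) ⟩
        coeff graphPoly (degrees S)   ≡⟨ coeff-graphPoly≡0 not-colourable e≤ (degrees S) m≤degree ⟩
        0ℚ                            ∎)
    where
    open ≡-Reasoning
    S : Fin n → List ℚ
    S = map fromℕ ∘ L
    h : (Fin n → ℚ) → ℚ
    h = eval graphPoly
    e≤ : length edges ≤ n * m
    e≤ = subst (_≤ n * m) (sym length-edges) e≤nm
    m≤degree : ∀ v → m ≤ degrees S v
    m≤degree v = subst (m ≤_) (cong (_∸ 1) (sym (List.length-map fromℕ (L v)))) (ℕ.∸-monoˡ-≤ 1 (L-long v))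
    S-unique : ∀ v → Unique (S v)
    S-unique v = Unique.map⁺ fromℕ-injective (L-unique v)
    S-nonempty : ∀ v → 1 ≤ length (S v)
    S-nonempty v = subst (1 ≤_) (sym (List.length-map fromℕ (L v))) (ℕ.≤-trans (s≤s z≤n) (L-long v))
    elsewhere≡0 : ∀ y → Pointwise _∈_ y S → ∃[ v ] y v ≢ fromℕ (f v) → h y ≡ 0ℚ
    elsewhere≡0 y y∈S (v , yᵥ≢fᵥ) = decidable-stable (h y ℚ.≟ 0ℚ) λ hy≢0 →
      let g , g∈L , y≡g = ∈-grid-map⁻ fromℕ L y∈S
      in no-other (g , g∈L , Proper-∘⁻ G fromℕ (Proper-resp-≗ G y≡g (graphPoly≢0⇒Proper y hy≢0)) ,
                   v , yᵥ≢fᵥ ∘ trans (y≡g v) ∘ cong fromℕ)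

lemma3p3 : (k n : ℕ) → 2 ≤ k → (G : Graph n) → StrongChromaticChoosable G k →
    edgeCount G ≤ n * (k ∸ 2) →
    (L : ListAssignment n) → WellFormed L → (∀ v → k ∸ 1 ≤ length (L v)) →
    ¬ (IsAssignment (k ∸ 1) L × Constant L) →
    Σ (Fin n → ℕ) λ f → Σ (Fin n → ℕ) λ g →
      ProperLColoring G L f × ProperLColoring G L g × (∃[ v ] f v ≢ g v)
lemma3p3 (suc zero)    _ (s≤s ()) _
lemma3p3 (suc (suc m)) n _ G choosable e≤ L L-unique L-long L-nonconst
  with f , f-colouring ← LColorable-nonConstant G choosable L L-unique L-long L-nonconst
  with OtherLColouring? G L f
... | yes (g , g∈L , g-proper , v , gᵥ≢fᵥ) = f , g , f-colouring , (g∈L , g-proper) , v , gᵥ≢fᵥ ∘ sym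
... | no no-other = ⊥-elim (¬¬OtherLColouring G (proj₁ choosable) e≤ L L-unique L-long f f-colouring no-other)
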